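{- If $n$ is a Zumkeller number, then $2n$ is a half-Zumkeller number.
   Context: A positive integer $n$ is a Zumkeller number if the set of all positive divisors of $n$ can be partitioned into two disjoint parts whose sums are equal. A positive integer $n$ is a half-Zumkeller number if the set of all positive divisors of $n$ other than $n$ itself can be partitioned into two disjoint parts whose sums are equal. -}

module Defs where

open import Data.Nat using (ℕ; suc; _∸_)
open import Data.Nat.Divisibility using (_∣?_)
open import Data.List using (List; filter; upTo; map)
open import Data.Nat.ListAction using (sum)
open import Data.Bool using (Bool; true; false; T; T?; not)
open import Data.Product using (∃)
open import Relation.Binary.PropositionalEquality using (_≡_)

range1 : ℕ → List ℕ
range1 m = map suc (upTo m)

divisors : ℕ → List ℕ
divisors n = filter (λ d → d ∣? n) (range1 n)

properDivisors : ℕ → List ℕ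
properDivisors n = filter (λ d → d ∣? n) (range1 (n ∸ 1))

sumColour : (ℕ → Bool) → Bool → List ℕ → ℕ
sumColour c true  xs = sum (filter (λ d → T? (c d)) xs)
sumColour c false xs = sum (filter (λ d → T? (not (c d))) xs)

-- a list of distinct numbers can be split into two disjoint parts with
-- equal sums: a 2-colouring of its elements with equal colour-class sums
EqualSumPartition : List ℕ → Set
EqualSumPartition xs = ∃ λ (c : ℕ → Bool) → sumColour c true xs ≡ sumColour c false xs

Zumkeller : ℕ → Set
Zumkeller n = EqualSumPartition (divisors n)

HalfZumkeller : ℕ → Set
HalfZumkeller n = EqualSumPartition (properDivisors n)

module Submission where

-- Let c be a colouring of the divisors of n with equal colour sums.  Call a
-- divisor d of n a top divisor if 2d does not divide n and d < n.  The
-- proper divisors of 2n are the divisors of n together with the numbers 2e,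
-- e a top divisor; odd divisors of 2n divide n, so nothing else occurs.
-- Colour the proper divisors of 2n by
--   * d ∣ n : the colour c d, flipped exactly when d is a top divisor;
--   * 2e    : the colour c e.
-- If T_b is the sum of the top divisors of c-colour b and Z_b the c-colour
-- sum of the divisors of n, then flipping moves T_b out of colour b and T_¬b
-- into it, while the doubled top divisors add 2 T_b; so the new colour-b sum
-- is Z_b + T_¬b + T_b.  As Z_true = Z_false, both colour sums agree.
--
-- To compute, every list sum over divisors is turned into a sum over an
-- initial segment of ℕ of a weight function (the number d if a Boolean
-- condition holds, 0 otherwise); the identities above are then pointwise
-- Boolean facts about these weights, summed up.

open import Defs
open import Data.Nat using (ℕ; zero; suc; _+_; _*_; _<_; _≤_; _<?_; pred; ⌊_/2⌋; z≤n; s≤s; z<s; NonZero; >-nonZero⁻¹)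
open import Data.Nat.Properties
open import Data.Nat.Divisibility using (_∣_; _∣?_; ∣⇒≤; ∣n⇒∣m*n; *-monoʳ-∣; *-cancelˡ-∣)
open import Data.Nat.Coprimality using (Coprime; 1-coprimeTo; coprime-+; coprime-divisor)
open import Data.Nat.ListAction using (sum)
open import Data.List using ([]; _∷_; filter; map; applyUpTo; upTo)
open import Data.List.Properties using (map-∘)
open import Data.Bool using (Bool; true; false; T; T?; not; _∧_; _xor_; if_then_else_)
open import Data.Bool.Properties using (∧-zeroʳ; not-involutive)
open import Data.Product using (_,_)
open import Data.Empty using (⊥-elim)
open import Function using (_∘_; id)
open import Function.Bundles using (mk⇔)
open import Relation.Nullary using (yes; no; does)
open import Relation.Nullary.Decidable using (dec-true; dec-false; does-⇔)
open import Relation.Unary using (Pred; Decidable)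
open import Relation.Binary.PropositionalEquality using (_≡_; refl; sym; trans; cong; cong₂; module ≡-Reasoning)
open import Algebra.Properties.CommutativeSemigroup +-commutativeSemigroup using (xy∙z≈xz∙y; interchange)

open ≡-Reasoning

sumBelow : ℕ → (ℕ → ℕ) → ℕ
sumBelow zero    f = 0
sumBelow (suc m) f = f 0 + sumBelow m (f ∘ suc)

sumBelow-cong : ∀ m {f g : ℕ → ℕ} → (∀ i → i < m → f i ≡ g i) → sumBelow m f ≡ sumBelow m g
sumBelow-cong zero    f≡g = refl
sumBelow-cong (suc m) f≡g = cong₂ _+_ (f≡g 0 z<s) (sumBelow-cong m (λ i i<m → f≡g (suc i) (s≤s i<m)))

sumBelow-+ : ∀ m (f g : ℕ → ℕ) → sumBelow m (λ i → f i + g i) ≡ sumBelow m f + sumBelow m g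
sumBelow-+ zero    f g = refl
sumBelow-+ (suc m) f g = begin
  f 0 + g 0 + sumBelow m (λ i → f (suc i) + g (suc i))   ≡⟨ cong (f 0 + g 0 +_) (sumBelow-+ m (f ∘ suc) (g ∘ suc)) ⟩
  f 0 + g 0 + (sumBelow m (f ∘ suc) + sumBelow m (g ∘ suc)) ≡⟨ interchange (f 0) (g 0) _ _ ⟩
  f 0 + sumBelow m (f ∘ suc) + (g 0 + sumBelow m (g ∘ suc)) ∎

sumBelow-* : ∀ m k (f : ℕ → ℕ) → sumBelow m (λ i → k * f i) ≡ k * sumBelow m f
sumBelow-* zero    k f = sym (*-zeroʳ k)
sumBelow-* (suc m) k f = trans (cong (k * f 0 +_) (sumBelow-* m k (f ∘ suc))) (sym (*-distribˡ-+ k (f 0) _))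

sumBelow-support : ∀ {m M} (f : ℕ → ℕ) → m ≤ M → (∀ i → m ≤ i → f i ≡ 0) → sumBelow M f ≡ sumBelow m f
sumBelow-support {zero}  {zero}  f _          _     = refl
sumBelow-support {zero}  {suc M} f _          zeros = cong₂ _+_ (zeros 0 z≤n) (sumBelow-support {zero} {M} (f ∘ suc) z≤n (λ i _ → zeros (suc i) z≤n))
sumBelow-support {suc m} {suc M} f (s≤s m≤M) zeros = cong (f 0 +_) (sumBelow-support (f ∘ suc) m≤M (λ i m≤i → zeros (suc i) (s≤s m≤i)))

sumBelow-pairs : ∀ m (f : ℕ → ℕ) → sumBelow (2 * m) f ≡ sumBelow m (λ i → f (2 * i) + f (suc (2 * i)))
sumBelow-pairs zero    f = refl
sumBelow-pairs (suc m) f = begin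
  sumBelow (2 * suc m) f                                  ≡⟨ cong (λ k → sumBelow k f) (*-suc 2 m) ⟩
  f 0 + (f 1 + sumBelow (2 * m) (f ∘ suc ∘ suc))          ≡⟨ +-assoc (f 0) (f 1) _ ⟨
  f 0 + f 1 + sumBelow (2 * m) (f ∘ suc ∘ suc)            ≡⟨ cong (f 0 + f 1 +_) (sumBelow-pairs m (f ∘ suc ∘ suc)) ⟩
  f 0 + f 1 + sumBelow m (λ i → f (2 + 2 * i) + f (3 + 2 * i))
    ≡⟨ cong (f 0 + f 1 +_) (sumBelow-cong m (λ i _ → cong (λ k → f k + f (suc k)) (sym (*-suc 2 i)))) ⟩
  sumBelow (suc m) (λ i → f (2 * i) + f (suc (2 * i)))    ∎

sum-map-applyUpTo : ∀ m (f g : ℕ → ℕ) → sum (map f (applyUpTo g m)) ≡ sumBelow m (f ∘ g)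
sum-map-applyUpTo zero    f g = refl
sum-map-applyUpTo (suc m) f g = cong (f (g 0) +_) (sum-map-applyUpTo m f (g ∘ suc))

sum-map-range1 : ∀ m (f : ℕ → ℕ) → f 0 ≡ 0 → sum (map f (range1 m)) ≡ sumBelow (suc m) f
sum-map-range1 m f f0≡0 = begin
  sum (map f (map suc (upTo m))) ≡⟨ cong sum (map-∘ (upTo m)) ⟨
  sum (map (f ∘ suc) (upTo m))   ≡⟨ sum-map-applyUpTo m (f ∘ suc) id ⟩
  sumBelow m (f ∘ suc)           ≡⟨ cong (_+ sumBelow m (f ∘ suc)) f0≡0 ⟨
  sumBelow (suc m) f             ∎

keepIf : Bool → ℕ → ℕ
keepIf p d = if p then d else 0

keepIf-0 : ∀ p → keepIf p 0 ≡ 0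
keepIf-0 true  = refl
keepIf-0 false = refl

keepIf-* : ∀ p k d → keepIf p (k * d) ≡ k * keepIf p d
keepIf-* true  k d = refl
keepIf-* false k d = sym (*-zeroʳ k)

sum-filter-filter : ∀ {p q} {P : Pred ℕ p} {Q : Pred ℕ q} (P? : Decidable P) (Q? : Decidable Q) xs →
                    sum (filter Q? (filter P? xs)) ≡ sum (map (λ x → keepIf (does (P? x) ∧ does (Q? x)) x) xs)
sum-filter-filter P? Q? []       = refl
sum-filter-filter P? Q? (x ∷ xs) with does (P? x)
... | false = sum-filter-filter P? Q? xs
... | true  with does (Q? x)
...   | true  = cong (x +_) (sum-filter-filter P? Q? xs)
...   | false = sum-filter-filter P? Q? xs

-- hasColour b x: the element coloured x lies in the class that sumColour _ b sums.
hasColour : Bool → Bool → Bool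
hasColour true  x = x
hasColour false x = not x

hasColour-not : ∀ b x → hasColour b (not x) ≡ hasColour (not b) x
hasColour-not true  x = refl
hasColour-not false x = not-involutive x

infix 6.5 _∣ᵇ_
_∣ᵇ_ : ℕ → ℕ → Bool
d ∣ᵇ m = does (d ∣? m)

∣ᵇ⇒∣ : ∀ {d m} → T (d ∣ᵇ m) → d ∣ m
∣ᵇ⇒∣ {d} {m} t with d ∣? m
... | yes d∣m = d∣m

∣⇒∣ᵇ : ∀ {d m} → d ∣ m → T (d ∣ᵇ m)
∣⇒∣ᵇ {d} {m} d∣m with d ∣? m
... | yes _   = _
... | no  d∤m = d∤m d∣m

*-cancelˡ-∣ᵇ : ∀ k .{{_ : NonZero k}} d m → k * d ∣ᵇ k * m ≡ d ∣ᵇ m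
*-cancelˡ-∣ᵇ k d m = does-⇔ (mk⇔ (*-cancelˡ-∣ k) (*-monoʳ-∣ k)) (k * d ∣? k * m) (d ∣? m)

colourWeight : ℕ → (ℕ → Bool) → Bool → ℕ → ℕ
colourWeight N γ b d = keepIf (d ∣ᵇ N ∧ hasColour b (γ d)) d

sumColour-divisorsIn : ∀ N γ b m →
  sumColour γ b (filter (_∣? N) (range1 m)) ≡ sumBelow (suc m) (colourWeight N γ b)
sumColour-divisorsIn N γ b m = trans (sumColour-filter b) (sum-map-range1 m _ (keepIf-0 _))
  where
  sumColour-filter : ∀ b → sumColour γ b (filter (_∣? N) (range1 m)) ≡ sum (map (colourWeight N γ b) (range1 m))
  sumColour-filter true  = sum-filter-filter (_∣? N) (λ d → T? (γ d)) (range1 m)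
  sumColour-filter false = sum-filter-filter (_∣? N) (λ d → T? (not (γ d))) (range1 m)

odd-coprime-2 : ∀ i → Coprime (suc (2 * i)) 2
odd-coprime-2 zero    = 1-coprimeTo 2
odd-coprime-2 (suc i) rewrite *-suc 2 i = coprime-+ (odd-coprime-2 i)

odd-divisor-of-double : ∀ i m → suc (2 * i) ∣ 2 * m → suc (2 * i) ∣ m
odd-divisor-of-double i m = coprime-divisor (odd-coprime-2 i)

⌊2n/2⌋≡n : ∀ n → ⌊ 2 * n /2⌋ ≡ n
⌊2n/2⌋≡n zero    = refl
⌊2n/2⌋≡n (suc n) rewrite *-suc 2 n = cong suc (⌊2n/2⌋≡n n)

n<2n : ∀ n .{{_ : NonZero n}} → n < 2 * n
n<2n n = m<m+n n (≤-trans (>-nonZero⁻¹ n) (m≤m+n n 0))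

keepIf-split : ∀ a a₂ β d → (T a → T a₂) → keepIf (a₂ ∧ β) d ≡ keepIf (a ∧ β) d + keepIf (a₂ ∧ not a ∧ β) d
keepIf-split true  true  β d _  = sym (+-identityʳ _)
keepIf-split true  false β d a⇒ = ⊥-elim (a⇒ _)
keepIf-split false a₂    β d _  = refl

rest-empty : ∀ a a₂ β → (T a₂ → T a) → (a₂ ∧ not a ∧ β) ≡ false
rest-empty a     false β _   = refl
rest-empty true  true  β _   = refl
rest-empty false true  β a₂⇒ = ⊥-elim (a₂⇒ _)

-- Flipping the colour x of an element exactly when t holds moves its weight
-- between the classes b and not b.
keepIf-flip : ∀ a t x y b d →
  keepIf (a ∧ hasColour b (if a then t xor x else y)) d + keepIf (a ∧ t ∧ hasColour b x) d
    ≡ keepIf (a ∧ hasColour b x) d + keepIf (a ∧ t ∧ hasColour (not b) x) d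
keepIf-flip false t     x y b d = refl
keepIf-flip true  false x y b d = refl
keepIf-flip true  true  x y b d = begin
  keepIf (hasColour b (not x)) d + keepIf (hasColour b x) d       ≡⟨ cong (λ p → keepIf p d + keepIf (hasColour b x) d) (hasColour-not b x) ⟩
  keepIf (hasColour (not b) x) d + keepIf (hasColour b x) d       ≡⟨ +-comm (keepIf (hasColour (not b) x) d) _ ⟩
  keepIf (hasColour b x) d + keepIf (hasColour (not b) x) d       ∎

guarded-if : ∀ a q y x b → (a ∧ not q ∧ hasColour b (if q then y else x)) ≡ (a ∧ not q ∧ hasColour b x)
guarded-if a true  y x b = refl
guarded-if a false y x b = refl

module Doubling (n : ℕ) .{{_ : NonZero n}} (c : ℕ → Bool) where

  isTop : ℕ → Bool
  isTop d = does (d <? n) ∧ not (2 * d ∣ᵇ n)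

  colour₂ : ℕ → Bool
  colour₂ d = if d ∣ᵇ n then isTop d xor c d else c ⌊ d /2⌋

  topWeight : Bool → ℕ → ℕ
  topWeight b d = keepIf (d ∣ᵇ n ∧ isTop d ∧ hasColour b (c d)) d

  newWeight : Bool → ℕ → ℕ
  newWeight b d = keepIf (d ∣ᵇ (2 * n) ∧ not (d ∣ᵇ n) ∧ hasColour b (colour₂ d)) d

  topSum : Bool → ℕ
  topSum b = sumBelow n (topWeight b)

  old-or-new : ∀ b d → colourWeight (2 * n) colour₂ b d ≡ colourWeight n colour₂ b d + newWeight b d
  old-or-new b d = keepIf-split (d ∣ᵇ n) (d ∣ᵇ (2 * n)) _ d (∣⇒∣ᵇ ∘ ∣n⇒∣m*n 2 ∘ ∣ᵇ⇒∣ {d} {n})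

  flip-top : ∀ b d → colourWeight n colour₂ b d + topWeight b d ≡ colourWeight n c b d + topWeight (not b) d
  flip-top b d = keepIf-flip (d ∣ᵇ n) (isTop d) (c d) (c ⌊ d /2⌋) b d

  new-even : ∀ b e → e < n → newWeight b (2 * e) ≡ 2 * topWeight b e
  new-even b e e<n = trans (cong (λ p → keepIf p (2 * e)) same-condition) (keepIf-* _ 2 e)
    where
    same-condition : (2 * e ∣ᵇ 2 * n ∧ not (2 * e ∣ᵇ n)
                        ∧ hasColour b (if 2 * e ∣ᵇ n then isTop (2 * e) xor c (2 * e) else c ⌊ 2 * e /2⌋))
                     ≡ (e ∣ᵇ n ∧ (does (e <? n) ∧ not (2 * e ∣ᵇ n)) ∧ hasColour b (c e))
    same-condition rewrite *-cancelˡ-∣ᵇ 2 e n | ⌊2n/2⌋≡n e | dec-true (e <? n) e<n =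
      guarded-if (e ∣ᵇ n) (2 * e ∣ᵇ n) _ (c e) b

  new-odd : ∀ b e → newWeight b (suc (2 * e)) ≡ 0
  new-odd b e = cong (λ p → keepIf p (suc (2 * e)))
    (rest-empty (suc (2 * e) ∣ᵇ n) (suc (2 * e) ∣ᵇ (2 * n)) _ (∣⇒∣ᵇ ∘ odd-divisor-of-double e n ∘ ∣ᵇ⇒∣))

  newSum : ∀ b → sumBelow (2 * n) (newWeight b) ≡ topSum b + topSum b
  newSum b = begin
    sumBelow (2 * n) (newWeight b)                                          ≡⟨ sumBelow-pairs n (newWeight b) ⟩
    sumBelow n (λ e → newWeight b (2 * e) + newWeight b (suc (2 * e)))      ≡⟨ sumBelow-cong n pair ⟩
    sumBelow n (λ e → 2 * topWeight b e)                                    ≡⟨ sumBelow-* n 2 (topWeight b) ⟩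
    2 * topSum b                                                            ≡⟨ cong (topSum b +_) (+-identityʳ _) ⟩
    topSum b + topSum b                                                     ∎
    where
    pair : ∀ e → e < n → newWeight b (2 * e) + newWeight b (suc (2 * e)) ≡ 2 * topWeight b e
    pair e e<n = trans (cong₂ _+_ (new-even b e e<n) (new-odd b e)) (+-identityʳ _)

  topSum-extend : ∀ b → sumBelow (2 * n) (topWeight b) ≡ topSum b
  topSum-extend b = sumBelow-support (topWeight b) (<⇒≤ (n<2n n)) beyond-n
    where
    beyond-n : ∀ d → n ≤ d → topWeight b d ≡ 0
    beyond-n d n≤d rewrite dec-false (d <? n) (≤⇒≯ n≤d) = cong (λ p → keepIf p d) (∧-zeroʳ (d ∣ᵇ n))

  colourSum₂ : ∀ b → sumBelow (2 * n) (colourWeight (2 * n) colour₂ b)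
                     ≡ sumBelow (2 * n) (colourWeight n c b) + topSum (not b) + topSum b
  colourSum₂ b = begin
    Σ (colourWeight (2 * n) colour₂ b)                 ≡⟨ sumBelow-cong (2 * n) (λ d _ → old-or-new b d) ⟩
    Σ (λ d → colourWeight n colour₂ b d + newWeight b d)  ≡⟨ sumBelow-+ (2 * n) _ _ ⟩
    Σ (colourWeight n colour₂ b) + Σ (newWeight b)     ≡⟨ cong (Σ (colourWeight n colour₂ b) +_) (newSum b) ⟩
    Σ (colourWeight n colour₂ b) + (topSum b + topSum b) ≡⟨ +-assoc _ (topSum b) (topSum b) ⟨
    Σ (colourWeight n colour₂ b) + topSum b + topSum b ≡⟨ cong (_+ topSum b) flip-sums ⟩
    Σ (colourWeight n c b) + topSum (not b) + topSum b ∎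
    where
    Σ : (ℕ → ℕ) → ℕ
    Σ = sumBelow (2 * n)

    flip-sums : Σ (colourWeight n colour₂ b) + topSum b ≡ Σ (colourWeight n c b) + topSum (not b)
    flip-sums = begin
      Σ (colourWeight n colour₂ b) + topSum b           ≡⟨ cong (Σ (colourWeight n colour₂ b) +_) (topSum-extend b) ⟨
      Σ (colourWeight n colour₂ b) + Σ (topWeight b)     ≡⟨ sumBelow-+ (2 * n) _ _ ⟨
      Σ (λ d → colourWeight n colour₂ b d + topWeight b d) ≡⟨ sumBelow-cong (2 * n) (λ d _ → flip-top b d) ⟩
      Σ (λ d → colourWeight n c b d + topWeight (not b) d) ≡⟨ sumBelow-+ (2 * n) _ _ ⟩
      Σ (colourWeight n c b) + Σ (topWeight (not b))     ≡⟨ cong (Σ (colourWeight n c b) +_) (topSum-extend (not b)) ⟩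
      Σ (colourWeight n c b) + topSum (not b)           ∎

  divisorSum : ∀ b → sumColour c b (divisors n) ≡ sumBelow (2 * n) (colourWeight n c b)
  divisorSum b = trans (sumColour-divisorsIn n c b n) (sym (sumBelow-support _ (n<2n n) beyond-n))
    where
    beyond-n : ∀ d → suc n ≤ d → colourWeight n c b d ≡ 0
    beyond-n d n<d = cong (λ a → keepIf (a ∧ hasColour b (c d)) d)
      (dec-false (d ∣? n) (λ d∣n → <⇒≱ n<d (∣⇒≤ d∣n)))

  properDivisorSum : ∀ b → sumColour colour₂ b (properDivisors (2 * n)) ≡ sumBelow (2 * n) (colourWeight (2 * n) colour₂ b)
  properDivisorSum b = trans (sumColour-divisorsIn (2 * n) colour₂ b (pred (2 * n)))
    (cong (λ m → sumBelow m (colourWeight (2 * n) colour₂ b)) (suc-pred (2 * n) {{m*n≢0 2 n}}))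

mainTheorem11 : (n : ℕ) → 0 < n → Zumkeller n → HalfZumkeller (2 * n)
mainTheorem11 n@(suc _) _ (c , balanced) = colour₂ , (begin
  sumColour colour₂ true (properDivisors (2 * n))  ≡⟨ properDivisorSum true ⟩
  Σ₂ (colourWeight (2 * n) colour₂ true)           ≡⟨ colourSum₂ true ⟩
  Σ₂ (colourWeight n c true) + topSum false + topSum true
    ≡⟨ cong (λ z → z + topSum false + topSum true) (trans (sym (divisorSum true)) (trans balanced (divisorSum false))) ⟩
  Σ₂ (colourWeight n c false) + topSum false + topSum true ≡⟨ xy∙z≈xz∙y _ (topSum false) (topSum true) ⟩
  Σ₂ (colourWeight n c false) + topSum true + topSum false ≡⟨ colourSum₂ false ⟨
  Σ₂ (colourWeight (2 * n) colour₂ false)          ≡⟨ properDivisorSum false ⟨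
  sumColour colour₂ false (properDivisors (2 * n)) ∎)
  where
  open Doubling n c
  Σ₂ : (ℕ → ℕ) → ℕ
  Σ₂ = sumBelow (2 * n)
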